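{- Let $\Psi$ be a weighted directed graph with finite vertex set ${\tt N}$, let $\aleph$ be a partition of ${\tt N}$ by which $\Psi$ is tree-divisible, let $F'\in{\cal F}^k(\Psi|\aleph)$ and let $F$ be a minimal principal of $F'$. Then $F\in\tilde{\cal F}^{*k}$ if and only if $F'\in\tilde{\cal F}^k(\Psi|\aleph)$.
   Context: $\Psi$ has real arc weights $\psi_{ij}$. An entering forest is a directed graph in which at most one arc leaves each vertex and there are no directed cycles; its components are entering trees, whose root is the unique vertex with no outgoing arc. ${\cal F}^k(G)$ is the set of spanning entering forests of $G$ with exactly $k$ trees. For a subgraph $G$ of $\Psi$ and ${\tt D}\subseteq{\tt N}$, $\Upsilon^G_{\tt D}=\sum_{(i,j)\in{\tt A}G,\ i\in{\tt D}}\psi_{ij}$, $\Upsilon^G=\Upsilon^G_{\tt N}$; $G|_{\tt D}$ is the induced subgraph. For a spanning subgraph $G$ of $\Psi$ and ${\tt D}\subseteq{\tt N}$: ${\cal T}^\bullet_{\tt D}(G)$ is the set of entering trees in $G$ with vertex set ${\tt D}$, $\lambda^\bullet_{\tt D}(G)=\min_{T\in{\cal T}^\bullet_{\tt D}(G)}\Upsilon^T$; ${\cal T}^\circ_{\tt D}(G)$ is the set of entering trees $T\subseteq G$ with ${\tt D}\subset{\tt V}T$, $|{\tt V}T|=|{\tt D}|+1$, $T|_{\tt D}\in{\cal T}^\bullet_{\tt D}(G)$. For distinct ${\tt X},{\tt Y}\in\aleph$, ${\cal T}_{\tt XY}(G)$ is the set of $T\in{\cal T}^\circ_{\tt X}(G)$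 with root in ${\tt Y}$, $\lambda_{\tt XY}(G)=\min_{T\in{\cal T}_{\tt XY}(G)}\Upsilon^T$. When $G=\Psi$ the argument is omitted. $G$ is tree-divisible by $\aleph$ if ${\cal T}^\bullet_{\tt X}(G)\ne\emptyset$ for all ${\tt X}\in\aleph$. The splitting $G|\aleph=G^\aleph$ of a tree-divisible $G$ has vertex set $\aleph$ and an arc $({\tt X},{\tt Y})$, ${\tt X}\ne{\tt Y}$, iff ${\cal T}_{\tt XY}(G)\ne\emptyset$, of weight $\lambda_{\tt XY}(G)-\lambda^\bullet_{\tt X}(G)$. $\tilde{\cal F}^k(\Psi|\aleph)$ is the set of forests in ${\cal F}^k(\Psi|\aleph)$ of minimum total weight (with the arc weights of $\Psi|\aleph$). ${\cal F}^{*k}$ is the set of forests in ${\cal F}^k(\Psi)$ that are tree-divisible by $\aleph$, and $\tilde{\cal F}^{*k}$ the set of those of minimum weight $\Upsilon^F$ within ${\cal F}^{*k}$. A tree-divisible $F\in{\cal F}^k(\Psi)$ is a principal of a spanning entering forest $F'$ of $\Psi|\aleph$ if the arc set of $F'$ equals that of $F^\aleph$; a minimal principal of $F'$ is a principal of minimal weight $\Upsilon^F$ among all principals of $F'$. -}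

module Defs where

open import Data.Nat using (ℕ; zero; suc)
open import Data.Bool using (Bool; true; false; if_then_else_; _∨_; T)
open import Data.Fin using (Fin; _≟_)
open import Data.List using (List; foldr; map; allFin)
open import Data.Maybe using (Maybe; just; nothing; maybe′; is-nothing; _>>=_)
open import Data.Product using (Σ; ∃; _×_; _,_)
open import Relation.Nullary using (¬_; does)
open import Relation.Binary.PropositionalEquality using (_≡_)
open import Relation.Binary.Structures using (IsTotalOrder)
open import Algebra.Structures using (IsAbelianGroup)
open import Function.Definitions using (Surjective)

-- Weights: a totally ordered abelian group (the reals are an instance).

record OrdAbGroup : Set₁ where
  infixl 6 _+_ _-_
  infix 4 _≤_
  field
    Carrier        : Set
    _+_            : Carrier → Carrier → Carrier
    0#             : Carrier
    -_             : Carrier → Carrier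
    _≤_            : Carrier → Carrier → Set
    isAbelianGroup : IsAbelianGroup _≡_ _+_ 0# -_
    isTotalOrder   : IsTotalOrder _≡_ _≤_
    +-monoˡ-≤      : ∀ {x y} z → x ≤ y → x + z ≤ y + z

  _-_ : Carrier → Carrier → Carrier
  x - y = x + (- y)

-- A subgraph in which at most one arc leaves each
-- vertex is encoded by its "outgoing arc" function  Fin n → Maybe (Fin n):
-- f v ≡ just w  iff  (v , w) is an arc of it.

Graph : ℕ → Set₁
Graph n = Fin n → Fin n → Set

VSet : ℕ → Set
VSet n = Fin n → Bool

Out : ℕ → Set
Out n = Fin n → Maybe (Fin n)

arcsOf : ∀ {n} → Out n → Graph n
arcsOf f v w = f v ≡ just w

InGraph : ∀ {n} → Graph n → Out n → Set
InGraph G f = ∀ v w → f v ≡ just w → G v w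

iter : ∀ {n} → Out n → ℕ → Fin n → Maybe (Fin n)
iter f zero    v = just v
iter f (suc m) v = iter f m v >>= f

Acyclic : ∀ {n} → Out n → Set
Acyclic f = ∀ v → ∃ λ m → iter f m v ≡ nothing

count : ∀ {n} → (Fin n → Bool) → ℕ
count {n} p = foldr (λ v k → if p v then suc k else k) zero (allFin n)

-- number of trees of a spanning entering forest = number of roots
numRoots : ∀ {n} → Out n → ℕ
numRoots f = count (λ v → is-nothing (f v))

SpanningForest : ∀ {n} → Graph n → ℕ → Out n → Set
SpanningForest G k f = InGraph G f × Acyclic f × numRoots f ≡ k

TreeOn : ∀ {n} → Graph n → VSet n → Out n → Set
TreeOn G D t =
  (∀ v → ¬ T (D v) → t v ≡ nothing) ×
  (∀ v w → t v ≡ just w → T (D v) × T (D w) × G v w) ×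
  Acyclic t ×
  (Σ _ λ r → T (D r) × t r ≡ nothing × (∀ v → T (D v) → t v ≡ nothing → v ≡ r))

restrict : ∀ {n} → VSet n → Out n → Out n
restrict D t v = if D v then (t v >>= λ w → if D w then just w else nothing) else nothing

insert : ∀ {n} → Fin n → VSet n → VSet n
insert u D v = D v ∨ does (v ≟ u)

-- Partitions: ℵ is given by a surjective labelling c : Fin n → Fin m;
-- the blocks are the fibres of c.

block : ∀ {n m} → (Fin n → Fin m) → Fin m → VSet n
block c X v = does (c v ≟ X)

TreeXY : ∀ {n m} → (Fin n → Fin m) → Graph n → Fin m → Fin m → Out n → Set
TreeXY c G X Y t =
  Σ _ λ u → ¬ T (block c X u) ×
    TreeOn G (insert u (block c X)) t ×
    TreeOn G (block c X) (restrict (block c X) t) ×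
    (Σ _ λ r → T (insert u (block c X) r) × t r ≡ nothing × T (block c Y r))

TreeDivisible : ∀ {n m} → (Fin n → Fin m) → Graph n → Set
TreeDivisible {m = m} c G = ∀ (X : Fin m) → ∃ λ t → TreeOn G (block c X) t

SplitArc : ∀ {n m} → (Fin n → Fin m) → Graph n → Graph m
SplitArc c G X Y = ¬ X ≡ Y × ∃ λ t → TreeXY c G X Y t

module _ (W : OrdAbGroup) where
  open OrdAbGroup W

  sumW : List Carrier → Carrier
  sumW = foldr _+_ 0#

  weight : ∀ {n} → (Fin n → Fin n → Carrier) → Out n → Carrier
  weight {n} ψ f = sumW (map (λ v → maybe′ (ψ v) 0# (f v)) (allFin n))

  IsMinWeight : ∀ {n} → (Fin n → Fin n → Carrier) → (Out n → Set) → Carrier → Set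
  IsMinWeight ψ P l = (∃ λ t → P t × weight ψ t ≡ l) × (∀ t → P t → l ≤ weight ψ t)

  -- weight of a spanning forest of Ψ|ℵ, where the arc (X,Y) of Ψ|ℵ has
  -- weight  lXY X Y - lB X  (lB = λ•_X, lXY = λ_XY)
  splitWeight : ∀ {m} → (Fin m → Carrier) → (Fin m → Fin m → Carrier) → Out m → Carrier
  splitWeight {m} lB lXY f' = sumW (map (λ X → maybe′ (λ Y → lXY X Y - lB X) 0# (f' X)) (allFin m))

  FStar : ∀ {n m} → Graph n → (Fin n → Fin m) → ℕ → Out n → Set
  FStar Ψ c k f = SpanningForest Ψ k f × TreeDivisible c (arcsOf f)

  FStarTilde : ∀ {n m} → Graph n → (Fin n → Fin n → Carrier) → (Fin n → Fin m) → ℕ → Out n → Set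
  FStarTilde Ψ ψ c k f = FStar Ψ c k f × (∀ g → FStar Ψ c k g → weight ψ f ≤ weight ψ g)

  SplitTilde : ∀ {n m} → Graph n → (Fin n → Fin m) → (Fin m → Carrier) → (Fin m → Fin m → Carrier) →
               ℕ → Out m → Set
  SplitTilde Ψ c lB lXY k f' =
    SpanningForest (SplitArc c Ψ) k f' ×
    (∀ g' → SpanningForest (SplitArc c Ψ) k g' → splitWeight lB lXY f' ≤ splitWeight lB lXY g')

Principal : ∀ {n m} → Graph n → (Fin n → Fin m) → ℕ → Out m → Out n → Set
Principal Ψ c k f' f =
  SpanningForest Ψ k f × TreeDivisible c (arcsOf f) ×
  (∀ X Y → (f' X ≡ just Y → SplitArc c (arcsOf f) X Y) × (SplitArc c (arcsOf f) X Y → f' X ≡ just Y))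

MinimalPrincipal : (W : OrdAbGroup) → ∀ {n m} → Graph n → (Fin n → Fin n → OrdAbGroup.Carrier W) →
                   (Fin n → Fin m) → ℕ → Out m → Out n → Set
MinimalPrincipal W Ψ ψ c k f' f =
  Principal Ψ c k f' f × (∀ g → Principal Ψ c k f' g → weight W ψ f ≤ weight W ψ g)
  where open OrdAbGroup W using (_≤_)

{-# OPTIONS --safe #-}
module Submission where

-- ℵ cuts every F ∈ 𝓕*ᵏ into one piece per block X: the arcs of F leaving vertices of X.
-- If the root of F's tree on X is a root of F the piece is an entering tree on X; otherwise
-- the arc at that root enters some block Y and the piece lies in 𝓣_XY.  Hence
-- Υ^F ≥ Σ_X λ•_X + Υ^{F^ℵ}, the last weight taken in Ψ|ℵ, and F^ℵ ∈ 𝓕ᵏ(Ψ|ℵ) (acyclic, same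
-- roots).  Conversely, gluing minimal trees along the arcs of any F' ∈ 𝓕ᵏ(Ψ|ℵ) gives a
-- principal of F' of weight exactly Σ_X λ•_X + Υ^{F'}.  So a minimal principal of F' has that
-- weight, and minimising Υ over 𝓕*ᵏ is minimising Υ over 𝓕ᵏ(Ψ|ℵ).

open import Defs
open import Algebra.Bundles using (AbelianGroup; CommutativeMonoid)
open import Data.Bool using (Bool; true; false; if_then_else_; T; T?)
open import Data.Bool.Properties using (T-∨; if-float)
open import Data.Fin using (Fin; zero; suc; _≟_)
open import Data.Fin.Properties using (punchInᵢ≢i)
open import Data.List as List using (allFin)
open import Data.List.Properties using (foldr-cong; foldr-map; map-tabulate)
open import Data.Maybe as Maybe using (Maybe; just; nothing; maybe′; is-nothing; _>>=_)
open import Data.Maybe.Properties using (just-injective)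
open import Data.Nat as Nat using (ℕ; zero; suc; _≤′_; ≤′-refl; ≤′-step; z≤n; s≤s)
open import Data.Nat.Properties using (≤⇒≤′; m≤m*n; m≤n+m; +-comm; +-0-commutativeMonoid)
import Data.Nat.Properties as ℕₚ
open import Data.Product using (Σ; ∃; _×_; _,_; proj₁; proj₂)
open import Data.Sum using (_⊎_; inj₁; inj₂)
open import Data.Unit using (tt)
open import Data.Vec.Functional as Vector using (Vector; removeAt)
open import Function using (_∘_; id; _$_)
open import Function.Bundles using (_⇔_; mk⇔; Equivalence)
open import Function.Definitions using (Surjective)
open import Level using (0ℓ)
open import Relation.Binary.Bundles using (Poset)
open import Relation.Binary.Core using (_⇒_)
open import Relation.Binary.Structures using (IsTotalOrder)
open import Relation.Binary.PropositionalEquality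
  using (_≡_; _≢_; _≗_; refl; sym; trans; cong; subst; subst₂; module ≡-Reasoning)
open import Relation.Nullary using (¬_; Dec; does; yes; no; contradiction)

T-does⁺ : ∀ {A : Set} (a? : Dec A) → A → T (does a?)
T-does⁺ (yes _) _ = tt
T-does⁺ (no ¬a) a = ¬a a

T-does⁻ : ∀ {A : Set} (a? : Dec A) → T (does a?) → A
T-does⁻ (yes a) _ = a

if-T : ∀ {a} {A : Set a} {b} {x y : A} → T b → (if b then x else y) ≡ x
if-T {b = true} _ = refl

if-¬T : ∀ {a} {A : Set a} {b} {x y : A} → ¬ T b → (if b then x else y) ≡ y
if-¬T {b = true}  b∉ = contradiction tt b∉
if-¬T {b = false} _  = refl

sameJust⇒≡ : ∀ {A : Set} {x y : Maybe A} →
             (∀ a → x ≡ just a → y ≡ just a) → (∀ a → y ≡ just a → x ≡ just a) → x ≡ y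
sameJust⇒≡ {x = just a}  x⇒y _   = sym (x⇒y a refl)
sameJust⇒≡ {x = nothing} {just b}  _ y⇒x = y⇒x b refl
sameJust⇒≡ {x = nothing} {nothing} _ _   = refl

module _ {n : ℕ} where
  open Nat using (_+_; _*_; _≤_)

  infix 4 _⊆_
  _⊆_ : Out n → Out n → Set
  t ⊆ g = InGraph (arcsOf g) t

  ⊆-trans : ∀ {s t g : Out n} → s ⊆ t → t ⊆ g → s ⊆ g
  ⊆-trans s⊆t t⊆g v w = t⊆g v w ∘ s⊆t v w

  iter-⊆ : ∀ {t g : Out n} → t ⊆ g → ∀ i {v w} → iter t i v ≡ just w → iter g i v ≡ just w
  iter-⊆ t⊆g zero eq = eq
  iter-⊆ {t} t⊆g (suc i) {v} eq with iter t i v in eqᵢ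
  ... | just x rewrite iter-⊆ t⊆g i eqᵢ = t⊆g x _ eq

  iter-cong : ∀ {t t' : Out n} → t ≗ t' → ∀ i v → iter t i v ≡ iter t' i v
  iter-cong t≗t' zero v = refl
  iter-cong {t' = t'} t≗t' (suc i) v rewrite iter-cong t≗t' i v with iter t' i v
  ... | just x  = t≗t' x
  ... | nothing = refl

  iter-+ : ∀ (f : Out n) i j v → iter f (i + j) v ≡ (iter f j v >>= iter f i)
  iter-+ f zero j v with iter f j v
  ... | just _  = refl
  ... | nothing = refl
  iter-+ f (suc i) j v rewrite iter-+ f i j v with iter f j v
  ... | just _  = refl
  ... | nothing = refl

  iter-suc-just : ∀ (f : Out n) i {v u} → f v ≡ just u → iter f (suc i) v ≡ iter f i u
  iter-suc-just f i {v} fv≡u = begin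
    iter f (suc i) v        ≡⟨ cong (λ k → iter f k v) (+-comm 1 i) ⟩
    iter f (i + 1) v        ≡⟨ iter-+ f i 1 v ⟩
    (f v >>= iter f i)      ≡⟨ cong (_>>= iter f i) fv≡u ⟩
    iter f i _              ∎
    where open ≡-Reasoning

  iter-join : ∀ (f : Out n) i j {v u x} → iter f i v ≡ just u → iter f j u ≡ x → iter f (j + i) v ≡ x
  iter-join f i j {v} {u} {x} p q = begin
    iter f (j + i) v         ≡⟨ iter-+ f j i v ⟩
    (iter f i v >>= iter f j) ≡⟨ cong (_>>= iter f j) p ⟩
    iter f j u               ≡⟨ q ⟩
    x                        ∎
    where open ≡-Reasoning

  iter-nothing-≤ : ∀ {f : Out n} {i j v} → iter f i v ≡ nothing → i ≤ j → iter f j v ≡ nothing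
  iter-nothing-≤ {f} {v = v} stop i≤j = go (≤⇒≤′ i≤j)
    where
    go : ∀ {j} → _ ≤′ j → iter f j v ≡ nothing
    go ≤′-refl = stop
    go (≤′-step i≤′j) rewrite go i≤′j = refl

  Acyclic-⊆ : ∀ {t g : Out n} → t ⊆ g → Acyclic g → Acyclic t
  Acyclic-⊆ {t} t⊆g acyclic v with acyclic v
  ... | M , stop with iter t M v in eq
  ...   | nothing = M , eq
  ...   | just w  = contradiction (trans (sym stop) (iter-⊆ t⊆g M eq)) λ ()

  Acyclic-cong : ∀ {t t' : Out n} → t ≗ t' → Acyclic t → Acyclic t'
  Acyclic-cong t≗t' acyclic v =
    let M , stop = acyclic v in M , trans (sym (iter-cong t≗t' M v)) stop

  Acyclic⇒noCycle : ∀ {g : Out n} → Acyclic g → ∀ p v → iter g (suc p) v ≢ just v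
  Acyclic⇒noCycle {g} acyclic p v cycle =
    let M , stop = acyclic v in
    contradiction (trans (sym (iter-nothing-≤ stop (m≤m*n M (suc p)))) (around M)) λ ()
    where
    around : ∀ q → iter g (q * suc p) v ≡ just v
    around zero    = refl
    around (suc q) = iter-join g (q * suc p) (suc p) (around q) cycle

  numRoots-cong : ∀ {f f' : Out n} → f ≗ f' → numRoots f ≡ numRoots f'
  numRoots-cong f≗f' =
    foldr-cong (λ v k → cong (λ o → if is-nothing o then suc k else k) (f≗f' v)) refl (allFin n)

  module Tree {G : Graph n} {D : VSet n} {t : Out n} (tree : TreeOn G D t) where

    outside : ∀ v → ¬ T (D v) → t v ≡ nothing
    outside = let outside , _ = tree in outside

    arc : ∀ {v w} → t v ≡ just w → T (D v) × T (D w) × G v w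
    arc = let _ , arc , _ = tree in arc _ _

    acyclic : Acyclic t
    acyclic = let _ , _ , acyclic , _ = tree in acyclic

    root : Fin n
    root = let _ , _ , _ , r , _ = tree in r

    root∈ : T (D root)
    root∈ = let _ , _ , _ , _ , r∈ , _ = tree in r∈

    root-nothing : t root ≡ nothing
    root-nothing = let _ , _ , _ , _ , _ , r-nothing , _ = tree in r-nothing

    root-unique : ∀ {v} → T (D v) → t v ≡ nothing → v ≡ root
    root-unique = let _ , _ , _ , _ , _ , _ , unique = tree in unique _

    stays : ∀ i {v x} → T (D v) → iter t i v ≡ just x → T (D x)
    stays zero v∈ refl = v∈
    stays (suc i) {v} v∈ eq with iter t i v
    ... | just y = proj₁ (proj₂ (arc eq))

    reach : ∀ {v} → T (D v) → ∃ λ i → iter t i v ≡ just root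
    reach {v} v∈ = let M , stop = acyclic v in go M stop
      where
      go : ∀ M → iter t M v ≡ nothing → ∃ λ i → iter t i v ≡ just root
      go (suc M) stop with iter t M v in eq
      ... | nothing = go M eq
      ... | just x  = M , trans eq (cong just (root-unique (stays M v∈ eq) stop))

  TreeOn-⊆ : ∀ {D : VSet n} {t g : Out n} → TreeOn (arcsOf g) D t → t ⊆ g
  TreeOn-⊆ tree _ _ = proj₂ ∘ proj₂ ∘ Tree.arc tree

  TreeOn-mono : ∀ {G G' : Graph n} {D t} → G ⇒ G' → TreeOn G D t → TreeOn G' D t
  TreeOn-mono G⇒G' (outside , arc , rest) =
    outside , (λ v w e → let v∈ , w∈ , a = arc v w e in v∈ , w∈ , G⇒G' a) , rest

  TreeOn-arcs⊆ : ∀ {G : Graph n} {D} {t g : Out n} → t ⊆ g → TreeOn G D t → TreeOn (arcsOf g) D t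
  TreeOn-arcs⊆ t⊆g (outside , arc , rest) =
    outside , (λ v w e → let v∈ , w∈ , _ = arc v w e in v∈ , w∈ , t⊆g v w e) , rest

  TreeOn-cong : ∀ {G : Graph n} {D} {t t' : Out n} → t ≗ t' → TreeOn G D t → TreeOn G D t'
  TreeOn-cong t≗t' (outside , arc , acyclic , r , r∈ , r-nothing , unique) =
    (λ v v∉ → trans (sym (t≗t' v)) (outside v v∉)) ,
    (λ v w e → arc v w (trans (t≗t' v) e)) ,
    Acyclic-cong t≗t' acyclic ,
    r , r∈ , trans (sym (t≗t' r)) r-nothing , (λ v v∈ e → unique v v∈ (trans (t≗t' v) e))

module _ {n : ℕ} where

  insert-self : ∀ u (D : VSet n) → T (insert u D u)
  insert-self u D = Equivalence.from (T-∨ {D u}) (inj₂ (T-does⁺ (u ≟ u) refl))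

  insert⁺ : ∀ {u} (D : VSet n) {v} → T (D v) → T (insert u D v)
  insert⁺ D {v} v∈ = Equivalence.from (T-∨ {D v}) (inj₁ v∈)

  insert⁻ : ∀ {u} (D : VSet n) {v} → T (insert u D v) → ¬ T (D v) → v ≡ u
  insert⁻ {u} D {v} v∈ v∉ with Equivalence.to (T-∨ {D v}) v∈
  ... | inj₁ v∈D = contradiction v∈D v∉
  ... | inj₂ v≡u = T-does⁻ (v ≟ u) v≡u

  -- Unlike restrict, keep D g retains the arcs from D that leave D.
  keep : VSet n → Out n → Out n
  keep D g v = if D v then g v else nothing

  keep-⊆ : ∀ (D : VSet n) g → keep D g ⊆ g
  keep-⊆ D g v w with D v
  ... | true  = id
  ... | false = λ ()

  keep-source : ∀ {D : VSet n} {g v w} → keep D g v ≡ just w → T (D v)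
  keep-source {D} {v = v} e with D v
  ... | true = tt
  keep-source () | false

  restrict-⊆ : ∀ (D : VSet n) t → restrict D t ⊆ t
  restrict-⊆ D t v w with D v | t v
  ... | false | _      = λ ()
  ... | true  | nothing = λ ()
  ... | true  | just x with D x
  ...   | true  = id
  ...   | false = λ ()

  restrict-in : ∀ (D : VSet n) t {v w} → T (D v) → t v ≡ just w → T (D w) → restrict D t v ≡ just w
  restrict-in D t {v} v∈ tv≡w w∈ with D v | t v
  ... | true | just x rewrite just-injective tv≡w = if-T w∈
  restrict-in D t () _ _ | false | _
  restrict-in D t _ () _ | true  | nothing

  restrict-leaving : ∀ (D : VSet n) t {v} → (∀ {w} → T (D v) → t v ≡ just w → ¬ T (D w)) →
                     restrict D t v ≡ nothing
  restrict-leaving D t {v} leaves with D v | t v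
  ... | false | _       = refl
  ... | true  | nothing = refl
  ... | true  | just w  = if-¬T (leaves tt refl)

  restrict-exit : ∀ (D : VSet n) t {v w} → T (D v) → t v ≡ just w → restrict D t v ≡ nothing → ¬ T (D w)
  restrict-exit D t v∈ tv≡w r≡nothing w∈ =
    contradiction (trans (sym r≡nothing) (restrict-in D t v∈ tv≡w w∈)) λ ()

  restrict-keep : ∀ (D : VSet n) g → restrict D (keep D g) ≗ restrict D g
  restrict-keep D g v with D v
  ... | true  = refl
  ... | false = refl

module Blocks {n m : ℕ} (c : Fin n → Fin m) where

  ∈block⁺ : ∀ {X v} → c v ≡ X → T (block c X v)
  ∈block⁺ {X} {v} = T-does⁺ (c v ≟ X)

  ∈block⁻ : ∀ {X v} → T (block c X v) → c v ≡ X
  ∈block⁻ {X} {v} = T-does⁻ (c v ≟ X)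

  TreeXY-mono : ∀ {G G' : Graph n} {X Y t} → G ⇒ G' → TreeXY c G X Y t → TreeXY c G' X Y t
  TreeXY-mono G⇒G' (u , u∉ , tree , blockTree , rest) =
    u , u∉ , TreeOn-mono G⇒G' tree , TreeOn-mono G⇒G' blockTree , rest

  SplitArc-mono : ∀ {G G' : Graph n} {X Y} → G ⇒ G' → SplitArc c G X Y → SplitArc c G' X Y
  SplitArc-mono G⇒G' (X≢Y , t , txy) = X≢Y , t , TreeXY-mono G⇒G' txy

module FinSum {a ℓ} (M : CommutativeMonoid a ℓ) where
  open CommutativeMonoid M using (Carrier; _≈_; _∙_; ε; setoid; reflexive; ∙-congˡ; identityʳ)
    renaming (sym to ≈-sym; trans to ≈-trans)
  open import Algebra.Properties.CommutativeMonoid.Sum M public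
  open import Relation.Binary.Reasoning.Setoid setoid

  ∑-single : ∀ {n} (f : Vector Carrier n) i → (∀ j → j ≢ i → f j ≈ ε) → sum f ≈ f i
  ∑-single {suc n} f i others = begin
    sum f                     ≈⟨ sum-remove f ⟩
    f i ∙ sum (removeAt f i)  ≈⟨ ∙-congˡ (≈-trans (sum-cong-≋ (λ j → others _ (punchInᵢ≢i i j)))
                                                  (sum-replicate-zero n)) ⟩
    f i ∙ ε                   ≈⟨ identityʳ (f i) ⟩
    f i                       ∎

  ∑-partition : ∀ {n m} (c : Fin n → Fin m) (f : Vector Carrier n) →
                sum f ≈ ∑[ X < m ] ∑[ v < n ] (if block c X v then f v else ε)
  ∑-partition {n} {m} c f = begin
    ∑[ v < n ] f v                                          ≈⟨ sum-cong-≋ (≈-sym ∘ inOwnBlock) ⟩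
    ∑[ v < n ] ∑[ X < m ] (if block c X v then f v else ε)
      ≈⟨ ∑-comm (λ v X → if block c X v then f v else ε) ⟩
    ∑[ X < m ] ∑[ v < n ] (if block c X v then f v else ε)  ∎
    where
    open Blocks c
    inOwnBlock : ∀ v → ∑[ X < m ] (if block c X v then f v else ε) ≈ f v
    inOwnBlock v = ≈-trans
      (∑-single _ (c v) (λ X X≢cv → reflexive (if-¬T (X≢cv ∘ sym ∘ ∈block⁻))))
      (reflexive (if-T (∈block⁺ refl)))

foldr-tabulate : ∀ {A B : Set} (f : A → B → B) e {n} (h : Fin n → A) →
                 List.foldr f e (List.tabulate h) ≡ Vector.foldr f e h
foldr-tabulate f e {zero}  h = refl
foldr-tabulate f e {suc n} h = cong (f (h zero)) (foldr-tabulate f e (h ∘ suc))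

foldr-map-allFin : ∀ {B : Set} (f : B → B → B) e {n} (h : Fin n → B) →
                   List.foldr f e (List.map h (allFin n)) ≡ Vector.foldr f e h
foldr-map-allFin f e h = trans (cong (List.foldr f e) (map-tabulate id h)) (foldr-tabulate f e h)

iverson : Bool → ℕ
iverson b = if b then 1 else 0

module ℕ∑ = FinSum +-0-commutativeMonoid

numRoots≡∑ : ∀ {n} (f : Out n) → numRoots f ≡ ℕ∑.sum (iverson ∘ is-nothing ∘ f)
numRoots≡∑ {n} f = begin
  numRoots f
    ≡⟨ foldr-cong (λ v k → sym (if-float (_+ k) (is-nothing (f v)))) refl (allFin n) ⟩
  List.foldr (λ v k → iverson (is-nothing (f v)) + k) 0 (allFin n)
    ≡⟨ foldr-map _+_ (iverson ∘ is-nothing ∘ f) 0 (allFin n) ⟨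
  List.foldr _+_ 0 (List.map (iverson ∘ is-nothing ∘ f) (allFin n))
    ≡⟨ foldr-map-allFin _+_ 0 (iverson ∘ is-nothing ∘ f) ⟩
  ℕ∑.sum (iverson ∘ is-nothing ∘ f)
    ∎
  where
  open ≡-Reasoning
  open Nat using (_+_)

module TreeXYProperties {n m : ℕ} {c : Fin n → Fin m} {G : Graph n} {X Y : Fin m} {t : Out n}
                    (X≢Y : X ≢ Y) (txy : TreeXY c G X Y t) where
  open Blocks c

  private
    exitVertex = proj₁ txy
    X∪u = insert exitVertex (block c X)
    module Whole = Tree (proj₁ (proj₂ (proj₂ txy)))

  module Inner = Tree (proj₁ (proj₂ (proj₂ (proj₂ txy))))

  private
    r = let _ , _ , _ , _ , r , _ = txy in r
    r∈ : T (X∪u r)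
    r∈ = let _ , _ , _ , _ , _ , r∈ , _ = txy in r∈
    r-nothing : t r ≡ nothing
    r-nothing = let _ , _ , _ , _ , _ , _ , r-nothing , _ = txy in r-nothing
    r∈Y : c r ≡ Y
    r∈Y = let _ , _ , _ , _ , _ , _ , _ , r∈Y = txy in ∈block⁻ r∈Y
    r∉X : ¬ T (block c X r)
    r∉X r∈X = X≢Y (trans (sym (∈block⁻ r∈X)) r∈Y)
    r≡exit : r ≡ exitVertex
    r≡exit = insert⁻ (block c X) r∈ r∉X

  arc : ∀ {v w} → t v ≡ just w → G v w
  arc = proj₂ ∘ proj₂ ∘ Whole.arc

  hasArc : ∀ {v} → T (block c X v) → t v ≢ nothing
  hasArc v∈ tv≡nothing = r∉X (subst (T ∘ block c X) v≡r v∈)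
    where
    v≡r = trans (Whole.root-unique (insert⁺ (block c X) v∈) tv≡nothing)
                (sym (Whole.root-unique r∈ r-nothing))

  source : ∀ {v w} → t v ≡ just w → T (block c X v)
  source {v} tv≡w with T? (block c X v)
  ... | yes v∈ = v∈
  ... | no v∉ = contradiction (trans (sym tv≡w) (trans (cong t v≡r) r-nothing)) λ ()
    where
    v≡r = trans (insert⁻ (block c X) (proj₁ (Whole.arc tv≡w)) v∉) (sym r≡exit)

  leaving⇒inY : ∀ {v w} → t v ≡ just w → ¬ T (block c X w) → c w ≡ Y
  leaving⇒inY tv≡w w∉ = trans (cong c (trans (insert⁻ (block c X) w∈ w∉) (sym r≡exit))) r∈Y
    where w∈ = proj₁ (proj₂ (Whole.arc tv≡w))

  inner-exit : Maybe.map c (t Inner.root) ≡ just Y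
  inner-exit with t Inner.root in tr
  ... | nothing = contradiction tr (hasArc Inner.root∈)
  ... | just w  =
    cong just (leaving⇒inY tr (restrict-exit (block c X) t Inner.root∈ tr Inner.root-nothing))

module Splitting {n m : ℕ} (c : Fin n → Fin m) (g : Out n) (td : TreeDivisible c (arcsOf g)) where
  open Blocks c
  open Nat using (_+_; _≤_)

  blockTree : Fin m → Out n
  blockTree X = proj₁ (td X)

  module BlockTree (X : Fin m) = Tree (proj₂ (td X))

  blockRoot : Fin m → Fin n
  blockRoot = BlockTree.root

  splitting : Out m
  splitting X = Maybe.map c (g (blockRoot X))

  blockTree-⊆ : ∀ X → blockTree X ⊆ g
  blockTree-⊆ X = TreeOn-⊆ (proj₂ (td X))

  blockTree-agrees : ∀ {X v} → T (block c X v) → v ≡ blockRoot X ⊎ blockTree X v ≡ g v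
  blockTree-agrees {X} {v} v∈ with blockTree X v in tv
  ... | nothing = inj₁ (BlockTree.root-unique X v∈ tv)
  ... | just w  = inj₂ (sym (blockTree-⊆ X v w tv))

  blockRoot-unique : ∀ {X v} → T (block c X v) → g v ≡ nothing → v ≡ blockRoot X
  blockRoot-unique {X} v∈ gv≡nothing with blockTree-agrees v∈
  ... | inj₁ v≡r = v≡r
  ... | inj₂ tv≡gv = BlockTree.root-unique X v∈ (trans tv≡gv gv≡nothing)

  reachBlockRoot : ∀ {X v} → T (block c X v) → ∃ λ i → iter g i v ≡ just (blockRoot X)
  reachBlockRoot {X} v∈ = let i , path = BlockTree.reach X v∈ in i , iter-⊆ (blockTree-⊆ X) i path

  keep-TreeOn : ∀ {X} → g (blockRoot X) ≡ nothing → TreeOn (arcsOf g) (block c X) (keep (block c X) g)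
  keep-TreeOn {X} gr = TreeOn-cong agree (proj₂ (td X))
    where
    agree : blockTree X ≗ keep (block c X) g
    agree v with T? (block c X v)
    ... | no v∉ = trans (BlockTree.outside X v v∉) (sym (if-¬T v∉))
    ... | yes v∈ with blockTree-agrees v∈
    ...   | inj₁ refl  = trans (BlockTree.root-nothing X) (sym (trans (if-T v∈) gr))
    ...   | inj₂ tv≡gv = trans tv≡gv (sym (if-T v∈))

  -- Every vertex of X reaches X's block root, whose arc (if any) leads into block splitting X.
  Acyclic-lift : Acyclic splitting → Acyclic g
  Acyclic-lift acyclic v = let M , stop = acyclic (c v) in lift M stop (∈block⁺ refl)
    where
    lift : ∀ M {X v} → iter splitting M X ≡ nothing → T (block c X v) → ∃ λ i → iter g i v ≡ nothing
    lift (suc M) {X} stop v∈ with reachBlockRoot v∈ | g (blockRoot X) in gr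
    ... | i , path | nothing = suc i , iter-join g i 1 path gr
    ... | i , path | just u  =
      let j , stop' = lift M (trans (sym (iter-suc-just splitting M (cong (Maybe.map c) gr))) stop)
                             (∈block⁺ refl)
      in j + suc i , iter-join g (suc i) j (iter-join g i 1 path gr) stop'

  numRoots-splitting : numRoots splitting ≡ numRoots g
  numRoots-splitting = begin
    numRoots splitting                                           ≡⟨ numRoots≡∑ splitting ⟩
    ℕ∑.sum (iverson ∘ is-nothing ∘ splitting)                     ≡⟨ ℕ∑.sum-cong-≗ (sym ∘ inBlock) ⟩
    ℕ∑.sum (λ X → ℕ∑.sum (λ v → if block c X v then iverson (is-nothing (g v)) else 0))
                                                                 ≡⟨ ℕ∑.∑-partition c _ ⟨
    ℕ∑.sum (iverson ∘ is-nothing ∘ g)                             ≡⟨ numRoots≡∑ g ⟨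
    numRoots g                                                   ∎
    where
    open ≡-Reasoning
    inBlock : ∀ X → ℕ∑.sum (λ v → if block c X v then iverson (is-nothing (g v)) else 0)
                    ≡ iverson (is-nothing (splitting X))
    inBlock X = trans (ℕ∑.∑-single _ (blockRoot X) notRoot) (trans (if-T (BlockTree.root∈ X)) atRoot)
      where
      notRoot : ∀ v → v ≢ blockRoot X → (if block c X v then iverson (is-nothing (g v)) else 0) ≡ 0
      notRoot v v≢r with T? (block c X v)
      ... | no v∉ = if-¬T v∉
      ... | yes v∈ with g v in gv
      ...   | nothing = contradiction (blockRoot-unique v∈ gv) v≢r
      ...   | just _  = if-T v∈
      atRoot : iverson (is-nothing (g (blockRoot X))) ≡ iverson (is-nothing (splitting X))
      atRoot with g (blockRoot X)
      ... | nothing = refl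
      ... | just _  = refl

  module _ (acyclic : Acyclic g) where

    rootArc-leaves : ∀ {X u} → g (blockRoot X) ≡ just u → ¬ T (block c X u)
    rootArc-leaves {X} {u} gr u∈ =
      let i , path = reachBlockRoot u∈ in Acyclic⇒noCycle acyclic i u (iter-join g i 1 path gr)

    blockTree≗restrict : ∀ X → blockTree X ≗ restrict (block c X) g
    blockTree≗restrict X v with blockTree X v in tv
    ... | just w  = let v∈ , w∈ , _ = BlockTree.arc X tv in
                    sym (restrict-in (block c X) g v∈ (blockTree-⊆ X v w tv) w∈)
    ... | nothing = sym (restrict-leaving (block c X) g λ v∈ gv →
                      rootArc-leaves (subst (λ x → g x ≡ just _) (BlockTree.root-unique X v∈ tv) gv))

    keep-TreeXY : ∀ {X u} → g (blockRoot X) ≡ just u → TreeXY c (arcsOf g) X (c u) (keep (block c X) g)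
    keep-TreeXY {X} {u} gr =
      u , u∉X , whole , inner , u , insert-self u (block c X) , if-¬T u∉X , ∈block⁺ refl
      where
      u∉X = rootArc-leaves gr
      X∪u = insert u (block c X)
      kept = keep (block c X) g

      target : ∀ {v w} → T (block c X v) → g v ≡ just w → T (X∪u w)
      target {v} v∈ gv with blockTree-agrees v∈
      ... | inj₁ v≡r   =
        subst (T ∘ X∪u) (just-injective (trans (sym gr) (subst (λ x → g x ≡ just _) v≡r gv)))
                        (insert-self u (block c X))
      ... | inj₂ tv≡gv = insert⁺ (block c X) (proj₁ (proj₂ (BlockTree.arc X (trans tv≡gv gv))))

      unique : ∀ v → T (X∪u v) → kept v ≡ nothing → v ≡ u
      unique v v∈ kv with T? (block c X v)
      ... | no v∉X  = insert⁻ (block c X) v∈ v∉X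
      ... | yes v∈X =
        contradiction (trans (sym gr) (subst (λ x → g x ≡ nothing) (blockRoot-unique v∈X gv) gv)) λ ()
        where gv = trans (sym (if-T v∈X)) kv

      arcs : ∀ v w → kept v ≡ just w → T (X∪u v) × T (X∪u w) × g v ≡ just w
      arcs v w kv = insert⁺ (block c X) v∈ , target v∈ gv , gv
        where
        v∈ = keep-source {D = block c X} {g = g} kv
        gv = keep-⊆ (block c X) g v w kv

      whole : TreeOn (arcsOf g) X∪u kept
      whole = (λ v v∉ → if-¬T (v∉ ∘ insert⁺ (block c X))) ,
              arcs ,
              Acyclic-⊆ (keep-⊆ (block c X) g) acyclic ,
              u , insert-self u (block c X) , if-¬T u∉X , unique

      inner : TreeOn (arcsOf g) (block c X) (restrict (block c X) kept)
      inner = TreeOn-cong (λ v → trans (blockTree≗restrict X v) (sym (restrict-keep (block c X) g v)))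
                          (proj₂ (td X))

    splitting⇒SplitArc : ∀ {X Y} → splitting X ≡ just Y → SplitArc c (arcsOf g) X Y
    splitting⇒SplitArc {X} sX with g (blockRoot X) in gr
    splitting⇒SplitArc {X} refl | just u = X≢cu , keep (block c X) g , keep-TreeXY gr
      where
      X≢cu : X ≢ c u
      X≢cu X≡cu = rootArc-leaves gr (∈block⁺ (sym X≡cu))

    SplitArc⇒splitting : ∀ {X Y} → SplitArc c (arcsOf g) X Y → splitting X ≡ just Y
    SplitArc⇒splitting {X} (X≢Y , t , txy) with t (blockRoot X) in tr
    ... | nothing = contradiction tr (hasArc (BlockTree.root∈ X))
      where open TreeXYProperties {c = c} X≢Y txy
    ... | just u  =
      trans (cong (Maybe.map c) (arc tr)) (cong just (leaving⇒inY tr (rootArc-leaves (arc tr))))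
      where open TreeXYProperties {c = c} X≢Y txy

    Acyclic-splitting : Acyclic splitting
    Acyclic-splitting X with acyclic (blockRoot X)
    ... | M , stop with iter splitting M X in eq
    ...   | nothing = M , eq
    ...   | just Y  = let j , M≤j , path = descend M eq in
                      contradiction (trans (sym (iter-nothing-≤ stop M≤j)) path) λ ()
      where
      descend : ∀ s {Y} → iter splitting s X ≡ just Y →
                ∃ λ j → s ≤ j × iter g j (blockRoot X) ≡ just (blockRoot Y)
      descend zero refl = 0 , z≤n , refl
      descend (suc s) eq with iter splitting s X in eqₛ
      ... | just Z with descend s eqₛ | g (blockRoot Z) in gZ
      ...   | j , s≤j , path | just u =
              let i , path' = BlockTree.reach _ (∈block⁺ (just-injective eq)) in
              i + suc j , ℕₚ.≤-trans (s≤s s≤j) (m≤n+m (suc j) i) ,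
              iter-join g (suc j) i (iter-join g j 1 path gZ) (iter-⊆ (blockTree-⊆ _) i path')

module Weights (W : OrdAbGroup) where
  open OrdAbGroup W

  abelianGroup : AbelianGroup 0ℓ 0ℓ
  abelianGroup = record
    { Carrier = Carrier ; _≈_ = _≡_ ; _∙_ = _+_ ; ε = 0# ; _⁻¹ = -_ ; isAbelianGroup = isAbelianGroup }

  open AbelianGroup abelianGroup using (commutativeMonoid; group)
  open AbelianGroup abelianGroup using (comm; identityʳ) public
  open import Algebra.Properties.Group group using (\\-leftDividesʳ; //-rightDividesˡ) public
  open FinSum commutativeMonoid public

  poset : Poset 0ℓ 0ℓ 0ℓ
  poset = record { isPartialOrder = IsTotalOrder.isPartialOrder isTotalOrder }

  open Poset poset using (antisym) renaming (refl to ≤-refl; trans to ≤-trans) public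

  +-monoʳ-≤ : ∀ z {x y} → x ≤ y → z + x ≤ z + y
  +-monoʳ-≤ z {x} {y} x≤y = subst₂ _≤_ (comm x z) (comm y z) (+-monoˡ-≤ z x≤y)

  +-mono-≤ : ∀ {x y u v} → x ≤ y → u ≤ v → x + u ≤ y + v
  +-mono-≤ {y = y} {u} x≤y u≤v = ≤-trans (+-monoˡ-≤ u x≤y) (+-monoʳ-≤ y u≤v)

  +-cancelˡ-≤ : ∀ z {x y} → z + x ≤ z + y → x ≤ y
  +-cancelˡ-≤ z {x} {y} le = subst₂ _≤_ (\\-leftDividesʳ z x) (\\-leftDividesʳ z y) (+-monoʳ-≤ (- z) le)

  ∑-mono-≤ : ∀ {k} {f h : Vector Carrier k} → (∀ i → f i ≤ h i) → sum f ≤ sum h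
  ∑-mono-≤ {zero}  f≤h = ≤-refl
  ∑-mono-≤ {suc k} f≤h = +-mono-≤ (f≤h zero) (∑-mono-≤ (f≤h ∘ suc))

  sumW≡sum : ∀ {k} (h : Vector Carrier k) → sumW W (List.map h (allFin k)) ≡ sum h
  sumW≡sum = foldr-map-allFin _+_ 0#

  weight≡∑ : ∀ {k} (ψ : Fin k → Fin k → Carrier) (f : Out k) →
             weight W ψ f ≡ ∑[ v < k ] maybe′ (ψ v) 0# (f v)
  weight≡∑ ψ f = sumW≡sum (λ v → maybe′ (ψ v) 0# (f v))

  weight-cong : ∀ {k} (ψ : Fin k → Fin k → Carrier) {f f' : Out k} → f ≗ f' →
                weight W ψ f ≡ weight W ψ f'
  weight-cong ψ {f} {f'} f≗f' = trans (weight≡∑ ψ f)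
    (trans (sum-cong-≗ λ v → cong (maybe′ (ψ v) 0#) (f≗f' v)) (sym (weight≡∑ ψ f')))

  weight-blocks : ∀ {n m} (c : Fin n → Fin m) (ψ : Fin n → Fin n → Carrier) (g : Out n) →
                  weight W ψ g ≡ ∑[ X < m ] weight W ψ (keep (block c X) g)
  weight-blocks {n} {m} c ψ g = begin
    weight W ψ g                                                                 ≡⟨ weight≡∑ ψ g ⟩
    ∑[ v < n ] maybe′ (ψ v) 0# (g v)                                             ≡⟨ ∑-partition c _ ⟩
    ∑[ X < m ] ∑[ v < n ] (if block c X v then maybe′ (ψ v) 0# (g v) else 0#)    ≡⟨ sum-cong-≗ inBlock ⟩
    ∑[ X < m ] weight W ψ (keep (block c X) g)                                   ∎
    where
    open ≡-Reasoning
    inBlock : ∀ X → ∑[ v < n ] (if block c X v then maybe′ (ψ v) 0# (g v) else 0#)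
                    ≡ weight W ψ (keep (block c X) g)
    inBlock X = trans (sum-cong-≗ λ v → sym (if-float (maybe′ (ψ v) 0#) (block c X v) {g v} {nothing}))
                      (sym (weight≡∑ ψ (keep (block c X) g)))

module PrincipalWeight (W : OrdAbGroup) {n m : ℕ}
  (Ψ : Graph n) (ψ : Fin n → Fin n → OrdAbGroup.Carrier W) (c : Fin n → Fin m)
  (lB : Fin m → OrdAbGroup.Carrier W)
  (hB : ∀ X → IsMinWeight W ψ (TreeOn Ψ (block c X)) (lB X))
  (lXY : Fin m → Fin m → OrdAbGroup.Carrier W)
  (hXY : ∀ X Y → X ≢ Y → ∃ (TreeXY c Ψ X Y) → IsMinWeight W ψ (TreeXY c Ψ X Y) (lXY X Y)) where
  open OrdAbGroup W
  open Weights W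
  open Blocks c

  cost : Fin m → Maybe (Fin m) → Carrier
  cost X = maybe′ (lXY X) (lB X)

  principalWeight : Out m → Carrier
  principalWeight f' = ∑[ X < m ] cost X (f' X)

  principalWeight-cong : ∀ {f' g'} → f' ≗ g' → principalWeight f' ≡ principalWeight g'
  principalWeight-cong f'≗g' = sum-cong-≗ λ X → cong (cost X) (f'≗g' X)

  principalWeight≡ : ∀ f' → principalWeight f' ≡ sum lB + splitWeight W lB lXY f'
  principalWeight≡ f' = begin
    ∑[ X < m ] cost X (f' X)                     ≡⟨ sum-cong-≗ (costSplit ∘ f') ⟩
    ∑[ X < m ] (lB X + arcWeight X (f' X))        ≡⟨ ∑-distrib-+ lB (λ X → arcWeight X (f' X)) ⟩
    sum lB + ∑[ X < m ] arcWeight X (f' X)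
      ≡⟨ cong (sum lB +_) (sumW≡sum (λ X → arcWeight X (f' X))) ⟨
    sum lB + splitWeight W lB lXY f'              ∎
    where
    open ≡-Reasoning
    arcWeight : Fin m → Maybe (Fin m) → Carrier
    arcWeight X = maybe′ (λ Y → lXY X Y - lB X) 0#
    costSplit : ∀ {X} o → cost X o ≡ lB X + arcWeight X o
    costSplit {X} nothing  = sym (identityʳ (lB X))
    costSplit {X} (just Y) = sym (trans (comm (lB X) _) (//-rightDividesˡ (lB X) (lXY X Y)))

  module _ {g : Out n} (g⊆Ψ : InGraph Ψ g) (acyclic : Acyclic g) (td : TreeDivisible c (arcsOf g)) where
    open Splitting c g td

    principalWeight-splitting≤weight : principalWeight splitting ≤ weight W ψ g
    principalWeight-splitting≤weight =
      subst (principalWeight splitting ≤_) (sym (weight-blocks c ψ g)) (∑-mono-≤ inBlock)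
      where
      inBlock : ∀ X → cost X (splitting X) ≤ weight W ψ (keep (block c X) g)
      inBlock X with g (blockRoot X) in gr
      ... | nothing = proj₂ (hB X) _ (TreeOn-mono (g⊆Ψ _ _) (keep-TreeOn gr))
      ... | just u  = proj₂ (hXY X (c u) X≢cu (_ , txy)) _ txy
        where
        txy = TreeXY-mono (g⊆Ψ _ _) (keep-TreeXY acyclic gr)
        X≢cu : X ≢ c u
        X≢cu X≡cu = rootArc-leaves acyclic gr (∈block⁺ (sym X≡cu))

    splitting∈ℱ : ∀ {k} → numRoots g ≡ k → SpanningForest (SplitArc c Ψ) k splitting
    splitting∈ℱ roots =
      (λ X Y → SplitArc-mono (g⊆Ψ _ _) ∘ splitting⇒SplitArc acyclic) ,
      Acyclic-splitting acyclic ,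
      trans numRoots-splitting roots

  -- What a principal of F' looks like on block X, where o = F' X.
  record BlockPiece (X : Fin m) (o : Maybe (Fin m)) : Set where
    field
      arcs        : Out n
      arcs⊆Ψ      : InGraph Ψ arcs
      source      : ∀ {v w} → arcs v ≡ just w → T (block c X v)
      weight≡cost : weight W ψ arcs ≡ cost X o
      tree        : Out n
      isTree      : TreeOn Ψ (block c X) tree
      tree⊆arcs   : tree ⊆ arcs
      exit        : Maybe.map c (arcs (Tree.root isTree)) ≡ o

  minimalPiece : ∀ X o → (∀ Y → o ≡ just Y → SplitArc c Ψ X Y) → BlockPiece X o
  minimalPiece X nothing _ with hB X
  ... | (t , isTree , weight≡) , _ = record
    { arcs = t ; arcs⊆Ψ = λ _ _ → proj₂ ∘ proj₂ ∘ Tree.arc isTree ; source = proj₁ ∘ Tree.arc isTree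
    ; weight≡cost = weight≡ ; tree = t ; isTree = isTree ; tree⊆arcs = λ _ _ → id
    ; exit = cong (Maybe.map c) (Tree.root-nothing isTree)
    }
  minimalPiece X (just Y) isArc with isArc Y refl
  ... | X≢Y , ∃txy with hXY X Y X≢Y ∃txy
  ...   | (t , txy , weight≡) , _ = record
    { arcs = t ; arcs⊆Ψ = λ _ _ → arc ; source = source
    ; weight≡cost = weight≡ ; tree = restrict (block c X) t ; isTree = proj₁ (proj₂ (proj₂ (proj₂ txy)))
    ; tree⊆arcs = restrict-⊆ (block c X) t ; exit = inner-exit
    }
    where open TreeXYProperties {c = c} X≢Y txy

  module Assembly (g' : Out m) (g'⊆Ψ|ℵ : InGraph (SplitArc c Ψ) g') where

    module Piece (X : Fin m) = BlockPiece (minimalPiece X (g' X) (g'⊆Ψ|ℵ X))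

    assembled : Out n
    assembled v = Piece.arcs (c v) v

    assembled-agrees : ∀ {X v} → T (block c X v) → assembled v ≡ Piece.arcs X v
    assembled-agrees {v = v} v∈ = cong (λ Z → Piece.arcs Z v) (∈block⁻ v∈)

    arcs⊆assembled : ∀ X → Piece.arcs X ⊆ assembled
    arcs⊆assembled X v w e = trans (assembled-agrees (Piece.source X e)) e

    keep-assembled : ∀ X → keep (block c X) assembled ≗ Piece.arcs X
    keep-assembled X v with T? (block c X v)
    ... | yes v∈ = trans (if-T v∈) (assembled-agrees v∈)
    ... | no v∉ with Piece.arcs X v in e
    ...   | nothing = if-¬T v∉
    ...   | just _  = contradiction (Piece.source X e) v∉

    treeDivisible : TreeDivisible c (arcsOf assembled)
    treeDivisible X =
      Piece.tree X , TreeOn-arcs⊆ (⊆-trans (Piece.tree⊆arcs X) (arcs⊆assembled X)) (Piece.isTree X)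

    open Splitting c assembled treeDivisible

    splitting≗g' : splitting ≗ g'
    splitting≗g' X =
      trans (cong (Maybe.map c) (assembled-agrees (Tree.root∈ (Piece.isTree X)))) (Piece.exit X)

    weight-assembled : weight W ψ assembled ≡ principalWeight g'
    weight-assembled = trans (weight-blocks c ψ assembled)
      (sum-cong-≗ λ X → trans (weight-cong ψ (keep-assembled X)) (Piece.weight≡cost X))

    principal : ∀ {k} → SpanningForest (SplitArc c Ψ) k g' → Principal Ψ c k g' assembled
    principal (_ , acyclic' , roots) =
      ((λ v w → Piece.arcs⊆Ψ (c v) v w) , acyclic ,
       trans (sym numRoots-splitting) (trans (numRoots-cong splitting≗g') roots)) ,
      treeDivisible ,
      λ X Y → (splitting⇒SplitArc acyclic ∘ trans (splitting≗g' X)) ,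
              (trans (sym (splitting≗g' X)) ∘ SplitArc⇒splitting acyclic)
      where
      acyclic : Acyclic assembled
      acyclic = Acyclic-lift (Acyclic-cong (sym ∘ splitting≗g') acyclic')

  assemble : ∀ {k g'} → SpanningForest (SplitArc c Ψ) k g' →
             Σ (Out n) λ g → Principal Ψ c k g' g × weight W ψ g ≡ principalWeight g'
  assemble {g' = g'} g'∈ℱ = assembled , principal g'∈ℱ , weight-assembled
    where open Assembly g' (proj₁ g'∈ℱ)

  splitting-bound : ∀ {k g} → FStar W Ψ c k g →
                    Σ (Out m) λ g' →
                      SpanningForest (SplitArc c Ψ) k g' × principalWeight g' ≤ weight W ψ g
  splitting-bound {g = g} ((g⊆Ψ , acyclic , roots) , td) =
    Splitting.splitting c g td , splitting∈ℱ g⊆Ψ acyclic td roots ,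
    principalWeight-splitting≤weight g⊆Ψ acyclic td

  minimalPrincipal-weight : ∀ {k f' f} → SpanningForest (SplitArc c Ψ) k f' →
                            MinimalPrincipal W Ψ ψ c k f' f → weight W ψ f ≡ principalWeight f'
  minimalPrincipal-weight {f' = f'} {f} f'∈ℱ (((f⊆Ψ , acyclic , _) , td , sameArcs) , minimal)
    with assemble f'∈ℱ
  ... | g , g-principal , weight-g =
    antisym (subst (weight W ψ f ≤_) weight-g (minimal g g-principal))
            (subst (_≤ weight W ψ f) (principalWeight-cong splitting≗f')
                   (principalWeight-splitting≤weight f⊆Ψ acyclic td))
    where
    open Splitting c f td
    splitting≗f' : splitting ≗ f'
    splitting≗f' X = sameJust⇒≡ (λ Y → proj₂ (sameArcs X Y) ∘ splitting⇒SplitArc acyclic)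
                                (λ Y → SplitArc⇒splitting acyclic ∘ proj₁ (sameArcs X Y))

theorem3 : (W : OrdAbGroup) (n m : ℕ)
    (Ψ : Graph n) (ψ : Fin n → Fin n → OrdAbGroup.Carrier W)
    (c : Fin n → Fin m) → Surjective _≡_ _≡_ c →
    TreeDivisible c Ψ →
    (lB : Fin m → OrdAbGroup.Carrier W) →
    (∀ X → IsMinWeight W ψ (TreeOn Ψ (block c X)) (lB X)) →
    (lXY : Fin m → Fin m → OrdAbGroup.Carrier W) →
    (∀ X Y → ¬ X ≡ Y → ∃ (TreeXY c Ψ X Y) → IsMinWeight W ψ (TreeXY c Ψ X Y) (lXY X Y)) →
    (k : ℕ) (f' : Out m) → SpanningForest (SplitArc c Ψ) k f' →
    (f : Out n) → MinimalPrincipal W Ψ ψ c k f' f →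
    FStarTilde W Ψ ψ c k f ⇔ SplitTilde W Ψ c lB lXY k f'
theorem3 W n m Ψ ψ c _ _ lB hB lXY hXY k f' f'∈ℱ f f-minimal@((f∈ℱ , f-td , _) , _) = mk⇔ to from
  where
  open OrdAbGroup W using (_+_)
  open Weights W using (sum; poset; +-monoʳ-≤; +-cancelˡ-≤)
  open PrincipalWeight W Ψ ψ c lB hB lXY hXY
  open import Relation.Binary.Reasoning.PartialOrder poset

  weight-f = minimalPrincipal-weight f'∈ℱ f-minimal

  to : FStarTilde W Ψ ψ c k f → SplitTilde W Ψ c lB lXY k f'
  to (_ , f-min) = f'∈ℱ , λ g' g'∈ℱ →
    let g , (g∈ℱ , g-td , _) , weight-g = assemble g'∈ℱ in
    +-cancelˡ-≤ (sum lB) $ begin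
      sum lB + splitWeight W lB lXY f' ≡⟨ principalWeight≡ f' ⟨
      principalWeight f'              ≡⟨ weight-f ⟨
      weight W ψ f                    ≤⟨ f-min g (g∈ℱ , g-td) ⟩
      weight W ψ g                    ≡⟨ weight-g ⟩
      principalWeight g'              ≡⟨ principalWeight≡ g' ⟩
      sum lB + splitWeight W lB lXY g' ∎

  from : SplitTilde W Ψ c lB lXY k f' → FStarTilde W Ψ ψ c k f
  from (_ , f'-min) = (f∈ℱ , f-td) , λ g g* →
    let g' , g'∈ℱ , g'≤g = splitting-bound g* in begin
      weight W ψ f                     ≡⟨ weight-f ⟩
      principalWeight f'               ≡⟨ principalWeight≡ f' ⟩
      sum lB + splitWeight W lB lXY f' ≤⟨ +-monoʳ-≤ (sum lB) (f'-min g' g'∈ℱ) ⟩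
      sum lB + splitWeight W lB lXY g' ≡⟨ principalWeight≡ g' ⟨
      principalWeight g'               ≤⟨ g'≤g ⟩
      weight W ψ g                     ∎
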